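{- Set replacement is logically equivalent to the existence of small set quotients. Here set replacement is the assertion that for all universes $\mathcal U,\mathcal V$ and every map $f:X\to Y$ where $X$ is $\mathcal U$-small and $Y$ is a locally $\mathcal V$-small set, the image $\mathrm{im}(f):=\Sigma_{y:Y}\exists_{x:X}\,f(x)=y$ is $(\mathcal U\sqcup\mathcal V)$-small; and existence of small set quotients is the assertion that for every type $X:\mathcal U$ and every $\mathcal V$-valued equivalence relation $\approx$ on $X$ there is a set $X/{\approx}$ in the universe $\mathcal U\sqcup\mathcal V$ together with a map $\eta:X\to X/{\approx}$ respecting $\approx$ (i.e. $x\approx y$ implies $\eta(x)=\eta(y)$) such that for every set $A$ in any universe and every $f:X\to A$ respecting $\approx$ there is a unique $\bar f:X/{\approx}\to A$ with $\bar f\circ\eta=f$.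
   Context: Setting: intensional Martin-Löf type theory with non-cumulative universes (join $\mathcal U\sqcup\mathcal V$), function extensionality, propositional extensionality and propositional truncations $\|-\|$ (truncation of a type in $\mathcal U$ lies in $\mathcal U$, with elimination into propositions of any universe); $\exists_{x:X}Y(x):=\|\Sigma_{x:X}Y(x)\|$. A set is a type whose identity types are propositions. A type is $\mathcal V$-small if it is equivalent to a type in $\mathcal V$; it is locally $\mathcal V$-small if all its identity types $x=y$ are $\mathcal V$-small. An equivalence relation on $X$ is a proposition-valued reflexive, symmetric, transitive relation $X\to X\to\mathcal V$. -}

{-# OPTIONS --without-K #-}
module Defs where

open import Agda.Primitive using (Level; _⊔_; lsuc; Setω)
open import Data.Product using (Σ; _,_; proj₁; proj₂; _×_)
open import Relation.Binary.PropositionalEquality using (_≡_)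

is-prop : ∀ {a} → Set a → Set a
is-prop X = (x y : X) → x ≡ y

is-set : ∀ {a} → Set a → Set a
is-set X = (x y : X) → is-prop (x ≡ y)

is-contr : ∀ {a} → Set a → Set a
is-contr X = Σ X (λ c → (x : X) → c ≡ x)

∃! : ∀ {a b} (X : Set a) → (X → Set b) → Set (a ⊔ b)
∃! X P = is-contr (Σ X P)

_∘_ : ∀ {a b c} {X : Set a} {Y : Set b} {Z : Set c} → (Y → Z) → (X → Y) → X → Z
(g ∘ f) x = g (f x)

is-equiv : ∀ {a b} {X : Set a} {Y : Set b} → (X → Y) → Set (a ⊔ b)
is-equiv {X = X} {Y} f =
  Σ (Y → X) (λ s → (y : Y) → f (s y) ≡ y) × Σ (Y → X) (λ r → (x : X) → r (f x) ≡ x)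

_≃_ : ∀ {a b} → Set a → Set b → Set (a ⊔ b)
X ≃ Y = Σ (X → Y) is-equiv

is-small : ∀ {a} (v : Level) → Set a → Set (a ⊔ lsuc v)
is-small v X = Σ (Set v) (λ Y → X ≃ Y)

is-locally-small : ∀ {a} (v : Level) → Set a → Set (a ⊔ lsuc v)
is-locally-small v X = (x y : X) → is-small v (x ≡ y)

FunExt : Setω
FunExt = ∀ {a b} {X : Set a} {Y : X → Set b} {f g : (x : X) → Y x}
         → ((x : X) → f x ≡ g x) → f ≡ g

PropExt : Setω
PropExt = ∀ {a} {P Q : Set a} → is-prop P → is-prop Q → (P → Q) → (Q → P) → P ≡ Q

record PropTrunc : Setω where
  field
    ∥_∥ : ∀ {a} → Set a → Set a
    ∥∥-is-prop : ∀ {a} {X : Set a} → is-prop ∥ X ∥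
    ∣_∣ : ∀ {a} {X : Set a} → X → ∥ X ∥
    ∥∥-rec : ∀ {a b} {X : Set a} {P : Set b} → is-prop P → (X → P) → ∥ X ∥ → P

module WithPT (pt : PropTrunc) where
  open PropTrunc pt

  ∃ : ∀ {a b} (X : Set a) → (X → Set b) → Set (a ⊔ b)
  ∃ X Y = ∥ Σ X Y ∥

  image : ∀ {a b} {X : Set a} {Y : Set b} → (X → Y) → Set (a ⊔ b)
  image {X = X} {Y} f = Σ Y (λ y → ∃ X (λ x → f x ≡ y))

  SetReplacement : Setω
  SetReplacement = ∀ {u v a b} {X : Set a} {Y : Set b} (f : X → Y)
    → is-small u X → is-locally-small v Y → is-set Y
    → is-small (u ⊔ v) (image f)

record EqRel {u} (v : Level) (X : Set u) : Set (u ⊔ lsuc v) where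
  field
    _≈_ : X → X → Set v
    ≈-prop : (x y : X) → is-prop (x ≈ y)
    ≈-refl : (x : X) → x ≈ x
    ≈-sym : (x y : X) → x ≈ y → y ≈ x
    ≈-trans : (x y z : X) → x ≈ y → y ≈ z → x ≈ z

respects : ∀ {u v a} {X : Set u} (R : EqRel v X) {A : Set a} → (X → A) → Set (u ⊔ v ⊔ a)
respects {X = X} R f = (x y : X) → EqRel._≈_ R x y → f x ≡ f y

record SetQuotient {u v} {X : Set u} (R : EqRel v X) : Setω where
  field
    X/≈ : Set (u ⊔ v)
    X/≈-is-set : is-set X/≈
    η : X → X/≈
    η-respects : respects R η
    universal : ∀ {a} (A : Set a) → is-set A → (f : X → A) → respects R f
              → ∃! (X/≈ → A) (λ f̄ → f̄ ∘ η ≡ f)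

SetQuotientsExist : Setω
SetQuotientsExist = ∀ {u v} (X : Set u) (R : EqRel v X) → SetQuotient R

record _⇔ω_ (A B : Setω) : Setω where
  field
    to : A → B
    from : B → A

{-# OPTIONS --without-K #-}

-- Given replacement, X/≈ is the image of x ↦ (x ≈_) : X → (X → Ω), a set which by
-- propositional extensionality is locally (U ⊔ V)-small; the corestriction onto the image
-- is surjective and effective, and any such map has the universal property of the quotient.
-- Conversely, the image of f : X → Y is the quotient of (a U-small copy of) X by the kernel
-- of f, which local smallness of Y makes V-valued.

module Submission where

open import Defs
open import Agda.Primitive using (Level; _⊔_; lsuc)
open import Axiom.UniquenessOfIdentityProofs using (module Constant⇒UIP)
open import Data.Product using (Σ; _,_; proj₁; proj₂; _×_)
open import Function.Bundles using (_↔_; Inverse; mk↔ₛ′)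
open import Function.Properties.Inverse using (↔-refl; ↔-sym; ↔-trans)
open import Relation.Binary.PropositionalEquality
  using (_≡_; refl; sym; trans; cong; cong₂; subst; module ≡-Reasoning)

private variable
  a b u v : Level
  X Y Z : Set a

constant-≡-endo⇒is-set : (k : ∀ {x y : X} → x ≡ y → x ≡ y)
  → (∀ {x y : X} (p q : x ≡ y) → k p ≡ k q) → is-set X
constant-≡-endo⇒is-set k k-constant x y = Constant⇒UIP.≡-irrelevant k k-constant

is-contr⇒is-prop : is-contr X → is-prop X
is-contr⇒is-prop (c , c≡) x y = trans (sym (c≡ x)) (c≡ y)

is-prop⇒is-set : is-prop X → is-set X
is-prop⇒is-set X-prop = constant-≡-endo⇒is-set (λ {x} {y} _ → X-prop x y) (λ _ _ → refl)

×-is-prop : is-prop X → is-prop Y → is-prop (X × Y)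
×-is-prop X-prop Y-prop (x , y) (x′ , y′) = cong₂ _,_ (X-prop x x′) (Y-prop y y′)

Σ-≡-prop : {B : X → Set b} → ((x : X) → is-prop (B x))
  → {w w′ : Σ X B} → proj₁ w ≡ proj₁ w′ → w ≡ w′
Σ-≡-prop B-prop {x , β} {.x , β′} refl = cong (x ,_) (B-prop x β β′)

Σ-is-set : {B : X → Set b} → is-set X → ((x : X) → is-prop (B x)) → is-set (Σ X B)
Σ-is-set X-set B-prop = constant-≡-endo⇒is-set
  (λ p → Σ-≡-prop B-prop (cong proj₁ p))
  (λ p q → cong (Σ-≡-prop B-prop) (X-set _ _ (cong proj₁ p) (cong proj₁ q)))

retract-is-prop : (r : Y → X) (s : X → Y) → (∀ x → r (s x) ≡ x) → is-prop Y → is-prop X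
retract-is-prop r s rs Y-prop x x′ = begin
  x           ≡⟨ sym (rs x) ⟩
  r (s x)     ≡⟨ cong r (Y-prop (s x) (s x′)) ⟩
  r (s x′)    ≡⟨ rs x′ ⟩
  x′          ∎
  where open ≡-Reasoning

retract-is-set : (r : Y → X) (s : X → Y) → (∀ x → r (s x) ≡ x) → is-set Y → is-set X
retract-is-set r s rs Y-set = constant-≡-endo⇒is-set
  (λ {x} {x′} p → trans (sym (rs x)) (trans (cong r (cong s p)) (rs x′)))
  (λ {x} {x′} p q → cong (λ t → trans (sym (rs x)) (trans (cong r t) (rs x′)))
                         (Y-set _ _ (cong s p) (cong s q)))

↔⇒≃ : X ↔ Y → X ≃ Y
↔⇒≃ e = to , (from , strictlyInverseˡ) , (from , strictlyInverseʳ)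
  where open Inverse e

≃⇒↔ : X ≃ Y → X ↔ Y
≃⇒↔ (f , (s , fs) , (r , rf)) = mk↔ₛ′ f s fs sf
  where
  sf : ∀ x → s (f x) ≡ x
  sf x = begin
    s (f x)          ≡⟨ sym (rf (s (f x))) ⟩
    r (f (s (f x)))  ≡⟨ cong r (fs (f x)) ⟩
    r (f x)          ≡⟨ rf x ⟩
    x                ∎
    where open ≡-Reasoning

⇔-props⇒is-equiv : {P : Set a} {Q : Set b} → is-prop P → is-prop Q
  → (f : P → Q) → (Q → P) → is-equiv f
⇔-props⇒is-equiv P-prop Q-prop f g = (g , λ _ → Q-prop _ _) , (g , λ _ → P-prop _ _)

is-small-self : (X : Set u) → is-small u X
is-small-self X = X , ↔⇒≃ ↔-refl

Ω : (v : Level) → Set (lsuc v)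
Ω v = Σ (Set v) is-prop

module _ (fe : FunExt) where

  Π-is-prop : {B : X → Set b} → ((x : X) → is-prop (B x)) → is-prop ((x : X) → B x)
  Π-is-prop B-prop f g = fe (λ x → B-prop x (f x) (g x))

  Π-is-set : {B : X → Set b} → ((x : X) → is-set (B x)) → is-set ((x : X) → B x)
  Π-is-set B-set = constant-≡-endo⇒is-set
    (λ p → fe (λ x → cong (λ h → h x) p))
    (λ p q → cong fe (fe (λ x → B-set x _ _ (cong (λ h → h x) p) (cong (λ h → h x) q))))

  is-prop-is-prop : is-prop (is-prop X)
  is-prop-is-prop X-prop X-prop′ =
    fe (λ x → fe (λ y → is-prop⇒is-set X-prop x y (X-prop x y) (X-prop′ x y)))

  module _ (pe : PropExt) where

    Ω-ext : (P Q : Ω v) → (proj₁ P → proj₁ Q) → (proj₁ Q → proj₁ P) → P ≡ Q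
    Ω-ext (P , P-prop) (Q , Q-prop) f g =
      Σ-≡-prop (λ _ → is-prop-is-prop) (pe P-prop Q-prop f g)

    Ω-is-set : is-set (Ω v)
    Ω-is-set = constant-≡-endo⇒is-set
      (λ {P} {Q} p → Ω-ext P Q (subst proj₁ p) (subst proj₁ (sym p)))
      (λ {P} {Q} p q → cong₂ (Ω-ext P Q) (fe (λ _ → proj₂ Q _ _)) (fe (λ _ → proj₂ P _ _)))

    Ω-valued-is-set : (X : Set u) → is-set (X → Ω v)
    Ω-valued-is-set X = Π-is-set (λ _ → Ω-is-set)

    Ω-valued-is-locally-small : (X : Set u) → is-locally-small (u ⊔ v) (X → Ω v)
    Ω-valued-is-locally-small X g h =
      pointwise-⇔ , to , ⇔-props⇒is-equiv (Ω-valued-is-set X g h) pointwise-⇔-is-prop to from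
      where
      pointwise-⇔ : Set _
      pointwise-⇔ = ∀ z → (proj₁ (g z) → proj₁ (h z)) × (proj₁ (h z) → proj₁ (g z))
      pointwise-⇔-is-prop : is-prop pointwise-⇔
      pointwise-⇔-is-prop = Π-is-prop (λ z →
        ×-is-prop (Π-is-prop (λ _ → proj₂ (h z))) (Π-is-prop (λ _ → proj₂ (g z))))
      to : g ≡ h → pointwise-⇔
      to refl z = (λ p → p) , (λ p → p)
      from : pointwise-⇔ → g ≡ h
      from w = fe (λ z → Ω-ext (g z) (h z) (proj₁ (w z)) (proj₂ (w z)))

    module _ {X : Set u} (R : EqRel v X) where
      open EqRel R

      class : X → X → Ω v
      class x y = (x ≈ y) , ≈-prop x y

      class-respects : respects R class
      class-respects x y x≈y = fe (λ z →
        Ω-ext (class x z) (class y z) (≈-trans y x z (≈-sym x y x≈y)) (≈-trans x y z x≈y))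

      class-effective : (x y : X) → class x ≡ class y → x ≈ y
      class-effective x y p = subst (λ k → proj₁ (k y)) (sym p) (≈-refl y)

module SetQuotientProperties (fe : FunExt) {X : Set u} {R : EqRel v X} (Q : SetQuotient R) where
  open SetQuotient Q

  lift : {A : Set a} → is-set A → (f : X → A) → respects R f → X/≈ → A
  lift {A = A} A-set f f-respects = proj₁ (proj₁ (universal A A-set f f-respects))

  lift-β : {A : Set a} (A-set : is-set A) (f : X → A) (f-respects : respects R f)
    → ∀ x → lift A-set f f-respects (η x) ≡ f x
  lift-β {A = A} A-set f f-respects x =
    cong (λ k → k x) (proj₂ (proj₁ (universal A A-set f f-respects)))

  fixes-η⇒≡id : (h : X/≈ → X/≈) → (∀ x → h (η x) ≡ η x) → ∀ q → h q ≡ q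
  fixes-η⇒≡id h h-fixes q = cong (λ k → k q) (cong proj₁
    (is-contr⇒is-prop (universal X/≈ X/≈-is-set η η-respects) (h , fe h-fixes) ((λ q → q) , refl)))

module _ (pt : PropTrunc) where
  open PropTrunc pt
  open WithPT pt

  fiber : (X → Y) → Y → Set _
  fiber {X = X} f y = Σ X (λ x → f x ≡ y)

  is-surjection : (X → Y) → Set _
  is-surjection {Y = Y} f = (y : Y) → ∥ fiber f y ∥

  ∘-is-surjection : {g : Y → Z} {f : X → Y}
    → is-surjection g → is-surjection f → is-surjection (g ∘ f)
  ∘-is-surjection {g = g} g-surj f-surj z = ∥∥-rec ∥∥-is-prop
    (λ { (y , gy≡z) → ∥∥-rec ∥∥-is-prop
      (λ { (x , fx≡y) → ∣ x , trans (cong g fx≡y) gy≡z ∣ }) (f-surj y) })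
    (g-surj z)

  ↔-is-surjection : (e : X ↔ Y) → is-surjection (Inverse.to e)
  ↔-is-surjection e y = ∣ Inverse.from e y , Inverse.strictlyInverseˡ e y ∣

  image-is-set : is-set Y → (f : X → Y) → is-set (image f)
  image-is-set Y-set f = Σ-is-set Y-set (λ _ → ∥∥-is-prop)

  image-≡ : {f : X → Y} {w w′ : image f} → proj₁ w ≡ proj₁ w′ → w ≡ w′
  image-≡ = Σ-≡-prop (λ _ → ∥∥-is-prop)

  corestriction : (f : X → Y) → X → image f
  corestriction f x = f x , ∣ x , refl ∣

  corestriction-is-surjection : (f : X → Y) → is-surjection (corestriction f)
  corestriction-is-surjection f (y , t) =
    ∥∥-rec ∥∥-is-prop (λ { (x , fx≡y) → ∣ x , image-≡ fx≡y ∣ }) t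

  image-∘-surjection : (f : X → Y) {r : Z → X} → is-surjection r → image (f ∘ r) ↔ image f
  image-∘-surjection f {r} r-surj = mk↔ₛ′ to from (λ _ → image-≡ refl) (λ _ → image-≡ refl)
    where
    to : image (f ∘ r) → image f
    to (y , t) = y , ∥∥-rec ∥∥-is-prop (λ { (z , p) → ∣ r z , p ∣ }) t
    from : image f → image (f ∘ r)
    from (y , t) = y , ∥∥-rec ∥∥-is-prop
      (λ { (x , fx≡y) → ∥∥-rec ∥∥-is-prop
        (λ { (z , rz≡x) → ∣ z , trans (cong f rz≡x) fx≡y ∣ }) (r-surj x) }) t

  module _ {A : Set a} (A-set : is-set A) {s : X → Z} (s-surj : is-surjection s) where

    surjection-≡ : (h k : Z → A) → (∀ x → h (s x) ≡ k (s x)) → ∀ z → h z ≡ k z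
    surjection-≡ h k h≡k z = ∥∥-rec (A-set _ _)
      (λ { (x , sx≡z) → subst (λ z → h z ≡ k z) sx≡z (h≡k x) }) (s-surj z)

    module _ (g : X → A) (g-constant : ∀ x y → s x ≡ s y → g x ≡ g y) where

      -- Any preimage of z determines the value at z, so the values form a proposition,
      -- which can be extracted from the truncated fiber of s.
      private
        value : Z → Set _
        value z = Σ A (λ a → ∥ Σ X (λ x → (s x ≡ z) × (g x ≡ a)) ∥)

        value-is-prop : (z : Z) → is-prop (value z)
        value-is-prop z (a , t) (a′ , t′) = Σ-≡-prop (λ _ → ∥∥-is-prop)
          (∥∥-rec (A-set a a′) (λ { (x , sx≡z , gx≡a) → ∥∥-rec (A-set a a′)
            (λ { (x′ , sx′≡z , gx′≡a′) → begin
              a      ≡⟨ sym gx≡a ⟩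
              g x    ≡⟨ g-constant x x′ (trans sx≡z (sym sx′≡z)) ⟩
              g x′   ≡⟨ gx′≡a′ ⟩
              a′     ∎ }) t′ }) t)
          where open ≡-Reasoning

        value-at : (z : Z) → value z
        value-at z = ∥∥-rec (value-is-prop z)
          (λ { (x , sx≡z) → g x , ∣ x , sx≡z , refl ∣ }) (s-surj z)

      surjection-extend : Z → A
      surjection-extend z = proj₁ (value-at z)

      surjection-extend-β : ∀ x → surjection-extend (s x) ≡ g x
      surjection-extend-β x =
        cong proj₁ (value-is-prop (s x) (value-at (s x)) (g x , ∣ x , refl , refl ∣))

  module _ (fe : FunExt) {X : Set u} (R : EqRel v X) where
    open EqRel R

    surjective-effective⇒SetQuotient : (Q : Set (u ⊔ v)) → is-set Q
      → (η : X → Q) → respects R η → is-surjection η → (∀ x y → η x ≡ η y → x ≈ y)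
      → SetQuotient R
    surjective-effective⇒SetQuotient Q Q-set η η-respects η-surj η-effective = record
      { X/≈ = Q
      ; X/≈-is-set = Q-set
      ; η = η
      ; η-respects = η-respects
      ; universal = universal
      }
      where
      universal : ∀ {a} (A : Set a) → is-set A → (f : X → A) → respects R f
        → ∃! (Q → A) (λ f̄ → f̄ ∘ η ≡ f)
      universal A A-set f f-respects =
        (f̄ , fe (surjection-extend-β A-set η-surj f f-constant)) ,
        λ { (h , h∘η≡f) → Σ-≡-prop (λ k → Π-is-set fe (λ _ → A-set) (k ∘ η) f)
          (fe (surjection-≡ A-set η-surj f̄ h
            (λ x → trans (surjection-extend-β A-set η-surj f f-constant x)
                         (sym (cong (λ k → k x) h∘η≡f))))) }
        where
        f-constant : ∀ x y → η x ≡ η y → f x ≡ f y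
        f-constant x y ηx≡ηy = f-respects x y (η-effective x y ηx≡ηy)
        f̄ : Q → A
        f̄ = surjection-extend A-set η-surj f f-constant

    quotient-from-small-image : {Y : Set b} → is-set Y → (f : X → Y)
      → respects R f → (∀ x y → f x ≡ f y → x ≈ y)
      → is-small (u ⊔ v) (image f) → SetQuotient R
    quotient-from-small-image Y-set f f-respects f-effective (Q , image≃Q) =
      surjective-effective⇒SetQuotient Q
        (retract-is-set to from strictlyInverseˡ (image-is-set Y-set f))
        (to ∘ corestriction f)
        (λ x y x≈y → cong to (image-≡ (f-respects x y x≈y)))
        (∘-is-surjection (↔-is-surjection e) (corestriction-is-surjection f))
        (λ x y p → f-effective x y (cong proj₁ (begin
          corestriction f x             ≡⟨ sym (strictlyInverseʳ _) ⟩
          from (to (corestriction f x)) ≡⟨ cong from p ⟩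
          from (to (corestriction f y)) ≡⟨ strictlyInverseʳ _ ⟩
          corestriction f y             ∎)))
      where
      open ≡-Reasoning
      e : image f ↔ Q
      e = ≃⇒↔ image≃Q
      open Inverse e

  module _ {Y : Set b} (Y-set : is-set Y) (Y-small : is-locally-small v Y) where

    small-≡ : Y → Y → Set v
    small-≡ y y′ = proj₁ (Y-small y y′)

    ≡↔small-≡ : (y y′ : Y) → (y ≡ y′) ↔ small-≡ y y′
    ≡↔small-≡ y y′ = ≃⇒↔ (proj₂ (Y-small y y′))

    ≡⇒small-≡ : {y y′ : Y} → y ≡ y′ → small-≡ y y′
    ≡⇒small-≡ {y} {y′} = Inverse.to (≡↔small-≡ y y′)

    small-≡⇒≡ : {y y′ : Y} → small-≡ y y′ → y ≡ y′
    small-≡⇒≡ {y} {y′} = Inverse.from (≡↔small-≡ y y′)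

    small-≡-is-prop : (y y′ : Y) → is-prop (small-≡ y y′)
    small-≡-is-prop y y′ =
      retract-is-prop ≡⇒small-≡ small-≡⇒≡ (Inverse.strictlyInverseˡ (≡↔small-≡ y y′)) (Y-set y y′)

    kernel : (g : Z → Y) → EqRel v Z
    kernel g = record
      { _≈_ = λ z z′ → small-≡ (g z) (g z′)
      ; ≈-prop = λ z z′ → small-≡-is-prop (g z) (g z′)
      ; ≈-refl = λ z → ≡⇒small-≡ refl
      ; ≈-sym = λ z z′ p → ≡⇒small-≡ (sym (small-≡⇒≡ p))
      ; ≈-trans = λ z z′ z″ p q → ≡⇒small-≡ (trans (small-≡⇒≡ p) (small-≡⇒≡ q))
      }

    image-↔-quotient-by-kernel : (fe : FunExt) (g : Z → Y) (Q : SetQuotient (kernel g))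
      → image g ↔ SetQuotient.X/≈ Q
    image-↔-quotient-by-kernel fe g Q = mk↔ₛ′ ψ φ ψ∘φ≡id φ∘ψ≡id
      where
      open SetQuotient Q
      open SetQuotientProperties fe Q
      cor-respects : respects (kernel g) (corestriction g)
      cor-respects z z′ p = image-≡ (small-≡⇒≡ p)
      φ : X/≈ → image g
      φ = lift (image-is-set Y-set g) (corestriction g) cor-respects
      φ-β : ∀ z → φ (η z) ≡ corestriction g z
      φ-β = lift-β (image-is-set Y-set g) (corestriction g) cor-respects
      η-constant : ∀ z z′ → corestriction g z ≡ corestriction g z′ → η z ≡ η z′
      η-constant z z′ p = η-respects z z′ (≡⇒small-≡ (cong proj₁ p))
      ψ : image g → X/≈
      ψ = surjection-extend X/≈-is-set (corestriction-is-surjection g) η η-constant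
      ψ-β : ∀ z → ψ (corestriction g z) ≡ η z
      ψ-β = surjection-extend-β X/≈-is-set (corestriction-is-surjection g) η η-constant
      ψ∘φ≡id : ∀ q → ψ (φ q) ≡ q
      ψ∘φ≡id = fixes-η⇒≡id (ψ ∘ φ) (λ z → trans (cong ψ (φ-β z)) (ψ-β z))
      φ∘ψ≡id : ∀ w → φ (ψ w) ≡ w
      φ∘ψ≡id = surjection-≡ (image-is-set Y-set g) (corestriction-is-surjection g)
        (φ ∘ ψ) (λ w → w) (λ z → trans (cong φ (ψ-β z)) (φ-β z))

  replacement⇒quotients : FunExt → PropExt → SetReplacement → SetQuotientsExist
  replacement⇒quotients fe pe replacement X R =
    quotient-from-small-image fe R (Ω-valued-is-set fe pe X) (class fe pe R)
      (class-respects fe pe R) (class-effective fe pe R)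
      (replacement (class fe pe R) (is-small-self X)
        (Ω-valued-is-locally-small fe pe X) (Ω-valued-is-set fe pe X))

  quotients⇒replacement : FunExt → SetQuotientsExist → SetReplacement
  quotients⇒replacement fe quotients {X = X} f (X′ , X≃X′) Y-small Y-set =
    X/≈ , ↔⇒≃ (↔-trans (↔-sym (image-∘-surjection f (↔-is-surjection (↔-sym e))))
                       (image-↔-quotient-by-kernel Y-set Y-small fe (f ∘ r) Q))
    where
    e : X ↔ X′
    e = ≃⇒↔ X≃X′
    r : X′ → X
    r = Inverse.from e
    Q : SetQuotient (kernel Y-set Y-small (f ∘ r))
    Q = quotients X′ (kernel Y-set Y-small (f ∘ r))
    open SetQuotient Q using (X/≈)

mainTheorem5 : FunExt → PropExt → (pt : PropTrunc)
    → WithPT.SetReplacement pt ⇔ω SetQuotientsExist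
mainTheorem5 fe pe pt = record
  { to = replacement⇒quotients pt fe pe
  ; from = quotients⇒replacement pt fe
  }
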